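{- Let $\Gamma$ be a finite abelian group and $\gamma_1,\gamma_2\in\Gamma$ such that $Cay(\Gamma,\{\pm\gamma_1,\pm\gamma_2\})$ is connected. Let $s=o(\gamma_1)$ and $t=|\Gamma|/s$. Then the smallest positive integer $a$ such that $a\gamma_2=r\gamma_1$ for some integer $r$ with $0\le r\le s-1$ is $a=t$. Consequently, with $r$ defined by $t\gamma_2=r\gamma_1$, $0\le r\le s-1$, the multigraph $Cay(\Gamma,\{\pm\gamma_1,\pm\gamma_2\})$ is isomorphic to $X(s,t,r)$ and to $X(s,t,s-r)$ (with $s-r$ read modulo $s$).
   Context: $Cay(\Gamma,\{\pm\gamma_1,\pm\gamma_2\})$ is the multigraph with vertex set $\Gamma$ and edge multiset $\{[x,x+\gamma_1],[x,x+\gamma_2]:x\in\Gamma\}$ (so it is $4$-regular, with parallel edges if some $\gamma_i$ is an involution and loops if some $\gamma_i=0$). For integers $s,t\ge1$ and $0\le r\le s-1$, $X(s,t,r)$ is the multigraph with vertex set $\{x^i_j:0\le i\le t-1,0\le j\le s-1\}$ and edge multiset consisting of the horizontal edges $[x^i_j,x^i_{j+1}]$ ($0\le i\le t-1$, $0\le j\le s-1$), the vertical edges $[x^i_j,x^{i+1}_j]$ ($0\le i\le t-2$, $0\le j\le s-1$) and the diagonal edges $[x^{t-1}_j,x^0_{j+r}]$ ($0\le j\le s-1$), subscripts modulo $s$. -}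

module Defs where

open import Level using (0ℓ)
open import Data.Nat using (ℕ; zero; suc; _+_; _∸_; _<_)
open import Data.Nat.DivMod using (_mod_)
open import Data.Fin using (Fin; toℕ; inject₁; fromℕ) renaming (zero to fzero; suc to fsuc)
open import Data.Product using (_×_; _,_; Σ; ∃; ∃-syntax)
open import Data.Sum using (_⊎_; inj₁; inj₂)
open import Data.Empty using (⊥)
open import Data.Bool using (Bool; true; false)
open import Relation.Binary.PropositionalEquality using (_≡_)
open import Relation.Nullary using (¬_)
open import Algebra.Structures using (IsAbelianGroup)
open import Function.Bundles using (_↔_; Inverse)

record FiniteAbelianGroup : Set₁ where
  infixl 6 _+ᴳ_
  field
    Carrier        : Set
    _+ᴳ_           : Carrier → Carrier → Carrier
    0ᴳ             : Carrier
    -ᴳ_            : Carrier → Carrier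
    isAbelianGroup : IsAbelianGroup _≡_ _+ᴳ_ 0ᴳ -ᴳ_
    size           : ℕ
    enum           : Fin size ↔ Carrier

open FiniteAbelianGroup public

_·_ : {Γ : FiniteAbelianGroup} → ℕ → Carrier Γ → Carrier Γ
_·_ {Γ} zero    g = 0ᴳ Γ
_·_ {Γ} (suc k) g = _+ᴳ_ Γ g (_·_ {Γ} k g)

IsOrder : (Γ : FiniteAbelianGroup) → Carrier Γ → ℕ → Set
IsOrder Γ g s =
  (0 < s) × (_·_ {Γ} s g ≡ 0ᴳ Γ) ×
  (∀ k → 0 < k → k < s → ¬ (_·_ {Γ} k g ≡ 0ᴳ Γ))

-- Multigraphs: a vertex type, an edge type (the edge multiset is indexed
-- by E), and for each edge its two endpoints (an undirected edge; the
-- order of the pair is irrelevant, see _≅_ below). Loops allowed.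

record Multigraph : Set₁ where
  field
    V    : Set
    E    : Set
    ends : E → V × V

open Multigraph public

record _≅_ (G H : Multigraph) : Set where
  field
    vmap : V G ↔ V H
    emap : E G ↔ E H
    preserves : ∀ e → let (u , v) = ends G e
                          φ = Inverse.to vmap
                      in ends H (Inverse.to emap e) ≡ (φ u , φ v)
                       ⊎ ends H (Inverse.to emap e) ≡ (φ v , φ u)

data Reach (G : Multigraph) : V G → V G → Set where
  here : ∀ {u} → Reach G u u
  fwd  : ∀ {u w} (e : E G) → ends G e ≡ (u , w) → ∀ {v} → Reach G w v → Reach G u v
  bwd  : ∀ {u w} (e : E G) → ends G e ≡ (w , u) → ∀ {v} → Reach G w v → Reach G u v

Connected : Multigraph → Set
Connected G = ∀ u v → Reach G u v

-- Cay(Γ, {±γ₁, ±γ₂}): vertex set Γ, edges [x, x+γ₁] (tag false) and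
-- [x, x+γ₂] (tag true) for every x ∈ Γ.

Cay : (Γ : FiniteAbelianGroup) → Carrier Γ → Carrier Γ → Multigraph
Cay Γ γ₁ γ₂ = record
  { V = Carrier Γ
  ; E = Carrier Γ × Bool
  ; ends = λ { (x , false) → (x , _+ᴳ_ Γ x γ₁)
             ; (x , true)  → (x , _+ᴳ_ Γ x γ₂) }
  }

-- X(s,t,r): vertices x^i_j = (i , j) with i : Fin t, j : Fin s.
-- Edges: horizontal (i,j)-(i,j+1) for i < t, j < s;
--        vertical   (i,j)-(i+1,j) for i ≤ t-2, j < s;
--        diagonal   (t-1,j)-(0,j+r) for j < s; subscripts modulo s.
-- Defined for s, t ≥ 1 (as in the paper); r is used only modulo s.
-- For s = 0 or t = 0 (outside the paper's domain) it is the empty graph.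

emptyGraph : Multigraph
emptyGraph = record { V = ⊥ ; E = ⊥ ; ends = λ () }

X : ℕ → ℕ → ℕ → Multigraph
X (suc s') (suc t') r = record
  { V = Fin (suc t') × Fin (suc s')
  ; E = (Fin (suc t') × Fin (suc s')) ⊎ (Fin t' × Fin (suc s')) ⊎ Fin (suc s')
  ; ends = λ
      { (inj₁ (i , j))        → ((i , j) , (i , (toℕ j + 1) mod (suc s')))
      ; (inj₂ (inj₁ (i , j))) → ((inject₁ i , j) , (fsuc i , j))
      ; (inj₂ (inj₂ j))       → ((fromℕ t' , j) , (fzero , (toℕ j + r) mod (suc s')))
      }
  }
X _ _ _ = emptyGraph

-- Write s = o(γ₁) and let a₀ be the least a > 0 such that a·γ₂ lies
-- in ⟨γ₁⟩, say a₀·γ₂ = r₀·γ₁ with r₀ < s ("a wraps").  The map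
--   (a , b) ↦ a·γ₂ + b·γ₁,   0 ≤ a < a₀, 0 ≤ b < s,
-- is injective (minimality of a₀ and of s) and surjective (its image
-- contains 0 and is invariant under ±γ₁, ±γ₂, hence is everything by
-- connectivity).  Counting gives |Γ| = a₀·s, so t = |Γ|/s = a₀ is the least
-- wrapping height.  In these coordinates the γ₁-edges are the horizontal
-- edges of X(s,t,r) and the γ₂-edges are its vertical and diagonal edges.
-- Replacing γ₂ by -γ₂ gives an isomorphic Cayley graph with the same least
-- wrapping height and residue (s-r) mod s, whence the second isomorphism.

module Submission where

open import Defs
open import Level using (0ℓ)
open import Data.Nat using (ℕ; zero; suc; pred; >-nonZero; _+_; _*_; _∸_; _<_; _≤_; NonZero; z≤n; s≤s; _<?_)
open import Data.Nat.Properties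
  using (≤-antisym; ≤-total; ≤-<-trans; ≮⇒≥; <⇒≤; m∸n≡0⇒m≤n; n≤0⇒n≡0; m∸n≤m; m+[n∸m]≡n;
         +-comm; n<1+n; m<n⇒0<n∸m; suc-pred; <⇒≱; anyUpTo?)
open import Data.Nat.DivMod using (_/_; _%_; _mod_; m≡m%n+[m/n]*n; m%n<n; m*n/n≡m)
open import Data.Nat.Induction using (<-rec)
open import Data.Fin using (Fin; toℕ; fromℕ<; inject₁; fromℕ) renaming (zero to fzero; suc to fsuc)
import Data.Fin as Fin
open import Data.Fin.Properties
  using (toℕ-fromℕ<; toℕ-injective; toℕ-inject₁; toℕ-fromℕ; toℕ<n; pigeonhole; *↔×)
open import Data.Fin.Relation.Unary.Top using (View; view; ‵fromℕ; ‵inj₁; view-fromℕ; view-inject₁)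
open import Data.Fin.Permutation using (↔⇒≡)
open import Data.Product using (_×_; ∃; ∃-syntax; _,_; proj₁; proj₂)
open import Data.Sum using (_⊎_; inj₁; inj₂; swap)
open import Data.Bool using (Bool; true; false)
open import Relation.Nullary using (¬_; Dec; yes; no)
open import Relation.Nullary.Decidable using (_×-dec_; via-injection)
open import Relation.Binary.Definitions using (DecidableEquality)
open import Relation.Binary.PropositionalEquality
open import Algebra.Bundles using (AbelianGroup)
open import Function.Bundles using (_↔_; _↣_; Inverse; Injection; mk↔ₛ′)
open import Function.Properties.Inverse using (↔⇒↣)
open import Function.Construct.Composition using (_↔-∘_)
open import Function.Construct.Symmetry using (↔-sym)
open import Function.Construct.Identity using (↔-id)

≤-difference : ∀ {m n} → m ≤ n → ¬ (0 < n ∸ m) → m ≡ n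
≤-difference m≤n nonpositive = ≤-antisym m≤n (m∸n≡0⇒m≤n (n≤0⇒n≡0 (≮⇒≥ nonpositive)))

least-witness : {P : ℕ → Set} → (∀ n → Dec (P n)) →
                ∀ n → P n → ∃[ m ] (P m × (∀ k → k < m → ¬ P k))
least-witness {P} P? = <-rec (λ n → P n → ∃[ m ] (P m × (∀ k → k < m → ¬ P k))) descend
  where
  descend : ∀ n → (∀ {k} → k < n → P k → ∃[ m ] (P m × (∀ k → k < m → ¬ P k))) →
            P n → ∃[ m ] (P m × (∀ k → k < m → ¬ P k))
  descend n smaller Pn with anyUpTo? P? n
  ... | yes (k , k<n , Pk) = smaller k<n Pk
  ... | no none            = n , Pn , λ k k<n Pk → none (k , k<n , Pk)

-- Multiples in a finite abelian group

module Multiples (Γ : FiniteAbelianGroup) where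

  group : AbelianGroup 0ℓ 0ℓ
  group = record { isAbelianGroup = isAbelianGroup Γ }

  open AbelianGroup group public
    using (_∙_; ε; _⁻¹; assoc; comm; identityˡ; identityʳ; inverseʳ)
  open import Algebra.Properties.Group (AbelianGroup.group group) public
    using (∙-cancelˡ; //-rightDividesˡ; //-rightDividesʳ)
  open import Algebra.Properties.CommutativeSemigroup (AbelianGroup.commutativeSemigroup group) public
    using (x∙yz≈xz∙y; xy∙z≈yz∙x)
  open import Algebra.Properties.CommutativeMonoid.Mult (AbelianGroup.commutativeMonoid group)
    using (×-homo-+; ×-distrib-+) renaming (_×_ to _×ᴹ_)

  infixr 8 _⊙_
  _⊙_ : ℕ → Carrier Γ → Carrier Γ
  k ⊙ g = _·_ {Γ} k g

  ⊙≡×ᴹ : ∀ k g → k ⊙ g ≡ k ×ᴹ g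
  ⊙≡×ᴹ zero    g = refl
  ⊙≡×ᴹ (suc k) g = cong (g ∙_) (⊙≡×ᴹ k g)

  ⊙-+ : ∀ m n g → (m + n) ⊙ g ≡ m ⊙ g ∙ n ⊙ g
  ⊙-+ m n g = begin
    (m + n) ⊙ g        ≡⟨ ⊙≡×ᴹ (m + n) g ⟩
    (m + n) ×ᴹ g       ≡⟨ ×-homo-+ g m n ⟩
    m ×ᴹ g ∙ n ×ᴹ g    ≡⟨ sym (cong₂ _∙_ (⊙≡×ᴹ m g) (⊙≡×ᴹ n g)) ⟩
    m ⊙ g ∙ n ⊙ g      ∎
    where open ≡-Reasoning

  ⊙-distrib : ∀ k x y → k ⊙ (x ∙ y) ≡ k ⊙ x ∙ k ⊙ y
  ⊙-distrib k x y = begin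
    k ⊙ (x ∙ y)        ≡⟨ ⊙≡×ᴹ k (x ∙ y) ⟩
    k ×ᴹ (x ∙ y)       ≡⟨ ×-distrib-+ x y k ⟩
    k ×ᴹ x ∙ k ×ᴹ y    ≡⟨ sym (cong₂ _∙_ (⊙≡×ᴹ k x) (⊙≡×ᴹ k y)) ⟩
    k ⊙ x ∙ k ⊙ y      ∎
    where open ≡-Reasoning

  ⊙-ε : ∀ k → k ⊙ ε ≡ ε
  ⊙-ε zero    = refl
  ⊙-ε (suc k) = trans (identityˡ (k ⊙ ε)) (⊙-ε k)

  ⊙-inverse : ∀ k g → k ⊙ g ∙ k ⊙ (g ⁻¹) ≡ ε
  ⊙-inverse k g = trans (sym (⊙-distrib k g (g ⁻¹))) (trans (cong (k ⊙_) (inverseʳ g)) (⊙-ε k))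

  ⊙-cancel : ∀ {m n} g → m ≤ n → m ⊙ g ≡ n ⊙ g → (n ∸ m) ⊙ g ≡ ε
  ⊙-cancel {m} {n} g m≤n m≡n = ∙-cancelˡ (m ⊙ g) ((n ∸ m) ⊙ g) ε (begin
    m ⊙ g ∙ (n ∸ m) ⊙ g  ≡⟨ sym (⊙-+ m (n ∸ m) g) ⟩
    (m + (n ∸ m)) ⊙ g    ≡⟨ cong (_⊙ g) (m+[n∸m]≡n m≤n) ⟩
    n ⊙ g                ≡⟨ sym m≡n ⟩
    m ⊙ g                ≡⟨ sym (identityʳ (m ⊙ g)) ⟩
    m ⊙ g ∙ ε            ∎)
    where open ≡-Reasoning

  index : Carrier Γ ↣ Fin (size Γ)
  index = ↔⇒↣ (↔-sym (enum Γ))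

  infix 4 _≟_
  _≟_ : DecidableEquality (Carrier Γ)
  _≟_ = via-injection index Fin._≟_

  -- Every element has a positive period: by pigeonhole two of the
  -- multiples 0·g, …, |Γ|·g coincide.
  period : ∀ g → ∃[ p ] (0 < p × p ⊙ g ≡ ε)
  period g with pigeonhole (n<1+n (size Γ)) (λ k → Injection.to index (toℕ k ⊙ g))
  ... | i , j , i<j , same =
    toℕ j ∸ toℕ i , m<n⇒0<n∸m i<j , ⊙-cancel g (<⇒≤ i<j) (Injection.injective index same)

  order-injective-≤ : ∀ {g s m n} → IsOrder Γ g s → m ≤ n → n < s → m ⊙ g ≡ n ⊙ g → m ≡ n
  order-injective-≤ {g = g} {m = m} {n = n} (_ , _ , minimal) m≤n n<s m≡n =
    ≤-difference m≤n λ positive →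
      minimal (n ∸ m) positive (≤-<-trans (m∸n≤m n m) n<s) (⊙-cancel g m≤n m≡n)

  order-injective : ∀ {g s m n} → IsOrder Γ g s → m < s → n < s → m ⊙ g ≡ n ⊙ g → m ≡ n
  order-injective {m = m} {n} ord m<s n<s m≡n with ≤-total m n
  ... | inj₁ m≤n = order-injective-≤ ord m≤n n<s m≡n
  ... | inj₂ n≤m = sym (order-injective-≤ ord n≤m m<s (sym m≡n))

  module Periodic (g : Carrier Γ) (s : ℕ) .{{_ : NonZero s}} (s⊙g : s ⊙ g ≡ ε) where

    ⊙-multiple : ∀ q → (q * s) ⊙ g ≡ ε
    ⊙-multiple zero    = refl
    ⊙-multiple (suc q) =
      trans (⊙-+ s (q * s) g) (trans (cong₂ _∙_ s⊙g (⊙-multiple q)) (identityˡ ε))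

    ⊙-mod : ∀ m → (m % s) ⊙ g ≡ m ⊙ g
    ⊙-mod m = sym (begin
      m ⊙ g                            ≡⟨ cong (_⊙ g) (m≡m%n+[m/n]*n m s) ⟩
      (m % s + (m / s) * s) ⊙ g        ≡⟨ ⊙-+ (m % s) ((m / s) * s) g ⟩
      (m % s) ⊙ g ∙ ((m / s) * s) ⊙ g  ≡⟨ cong ((m % s) ⊙ g ∙_) (⊙-multiple (m / s)) ⟩
      (m % s) ⊙ g ∙ ε                  ≡⟨ identityʳ ((m % s) ⊙ g) ⟩
      (m % s) ⊙ g                      ∎)
      where open ≡-Reasoning

    ⊙-subtract : ∀ {x m n} → x ∙ n ⊙ g ≡ m ⊙ g → n ≤ s → x ≡ (m + (s ∸ n)) ⊙ g
    ⊙-subtract {x} {m} {n} x+ng≡mg n≤s = begin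
      x                          ≡⟨ sym (identityʳ x) ⟩
      x ∙ ε                      ≡⟨ cong (x ∙_) (sym s⊙g) ⟩
      x ∙ s ⊙ g                  ≡⟨ cong (λ k → x ∙ k ⊙ g) (sym (m+[n∸m]≡n n≤s)) ⟩
      x ∙ (n + (s ∸ n)) ⊙ g      ≡⟨ cong (x ∙_) (⊙-+ n (s ∸ n) g) ⟩
      x ∙ (n ⊙ g ∙ (s ∸ n) ⊙ g)  ≡⟨ sym (assoc x (n ⊙ g) ((s ∸ n) ⊙ g)) ⟩
      x ∙ n ⊙ g ∙ (s ∸ n) ⊙ g    ≡⟨ cong (_∙ (s ∸ n) ⊙ g) x+ng≡mg ⟩
      m ⊙ g ∙ (s ∸ n) ⊙ g        ≡⟨ sym (⊙-+ m (s ∸ n) g) ⟩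
      (m + (s ∸ n)) ⊙ g          ∎
      where open ≡-Reasoning

    -- A property of elements closed under adding g is also closed under
    -- subtracting g, because -g = (s - 1)·g.
    closed-under-inverse : (P : Carrier Γ → Set) → (∀ x → P x → P (x ∙ g)) →
                           ∀ x → P (x ∙ g) → P x
    closed-under-inverse P closed x P[x+g] =
      subst P x+g+[s-1]g≡x (add-multiple (pred s) (x ∙ g) P[x+g])
      where
      add-multiple : ∀ k y → P y → P (y ∙ k ⊙ g)
      add-multiple zero    y Py = subst P (sym (identityʳ y)) Py
      add-multiple (suc k) y Py =
        subst P (assoc y g (k ⊙ g)) (add-multiple k (y ∙ g) (closed y Py))

      x+g+[s-1]g≡x : x ∙ g ∙ pred s ⊙ g ≡ x
      x+g+[s-1]g≡x = begin
        x ∙ g ∙ pred s ⊙ g      ≡⟨ assoc x g (pred s ⊙ g) ⟩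
        x ∙ suc (pred s) ⊙ g    ≡⟨ cong (λ k → x ∙ k ⊙ g) (suc-pred s) ⟩
        x ∙ s ⊙ g               ≡⟨ cong (x ∙_) s⊙g ⟩
        x ∙ ε                   ≡⟨ identityʳ x ⟩
        x                       ∎
        where open ≡-Reasoning

-- Multigraph isomorphisms and walks

Joins : {A B : Set} → (A → B) → A × A → B × B → Set
Joins f (u , v) q = q ≡ (f u , f v) ⊎ q ≡ (f v , f u)

joins-inverse : {A B : Set} (φ : A ↔ B) {p : A × A} {q : B × B} →
                Joins (Inverse.to φ) p q → Joins (Inverse.from φ) q p
joins-inverse φ {p = u , v} (inj₁ refl) =
  inj₁ (sym (cong₂ _,_ (Inverse.strictlyInverseʳ φ u) (Inverse.strictlyInverseʳ φ v)))
joins-inverse φ {p = u , v} (inj₂ refl) =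
  inj₂ (sym (cong₂ _,_ (Inverse.strictlyInverseʳ φ u) (Inverse.strictlyInverseʳ φ v)))

joins-swap : {A B : Set} {f : A → B} {u v : A} {q : B × B} → Joins f (u , v) q → Joins f (v , u) q
joins-swap = swap

joins-∘ : {A B C : Set} {f : A → B} {g : B → C} {p : A × A} {q : B × B} {r : C × C} →
          Joins f p q → Joins g q r → Joins (λ x → g (f x)) p r
joins-∘ {p = u , v} (inj₁ refl) (inj₁ refl) = inj₁ refl
joins-∘ {p = u , v} (inj₁ refl) (inj₂ refl) = inj₂ refl
joins-∘ {p = u , v} (inj₂ refl) (inj₁ refl) = inj₂ refl
joins-∘ {p = u , v} (inj₂ refl) (inj₂ refl) = inj₁ refl

≅-sym : ∀ {G H} → G ≅ H → H ≅ G
≅-sym {G} {H} i = record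
  { vmap = ↔-sym vmap
  ; emap = ↔-sym emap
  ; preserves = λ e → joins-inverse vmap
      (subst (Joins (Inverse.to vmap) (ends G (Inverse.from emap e)))
             (cong (ends H) (Inverse.strictlyInverseˡ emap e))
             (preserves (Inverse.from emap e)))
  }
  where open _≅_ i

≅-trans : ∀ {G H K} → G ≅ H → H ≅ K → G ≅ K
≅-trans i j = record
  { vmap = _≅_.vmap j ↔-∘ _≅_.vmap i
  ; emap = _≅_.emap j ↔-∘ _≅_.emap i
  ; preserves = λ e → joins-∘ {f = Inverse.to (_≅_.vmap i)} {g = Inverse.to (_≅_.vmap j)}
                         (_≅_.preserves i e) (_≅_.preserves j (Inverse.to (_≅_.emap i) e))
  }

module _ {G H : Multigraph} (i : G ≅ H) where
  open _≅_ i
  private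
    φ : V G → V H
    φ = Inverse.to vmap

    traverse : ∀ {u w v} e → Joins φ (u , w) (ends H e) → Reach H (φ w) v → Reach H (φ u) v
    traverse e (inj₁ ends≡) walk = fwd e ends≡ walk
    traverse e (inj₂ ends≡) walk = bwd e ends≡ walk

    image-joins : ∀ {p} e → ends G e ≡ p → Joins φ p (ends H (Inverse.to emap e))
    image-joins e refl = preserves e

  ≅-reach : ∀ {u v} → Reach G u v → Reach H (φ u) (φ v)
  ≅-reach here               = here
  ≅-reach (fwd e ends≡ walk) = traverse (Inverse.to emap e) (image-joins e ends≡) (≅-reach walk)
  ≅-reach (bwd e ends≡ walk) =
    traverse (Inverse.to emap e) (joins-swap {f = φ} (image-joins e ends≡)) (≅-reach walk)

  ≅-connected : Connected G → Connected H
  ≅-connected connected u v =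
    subst₂ (Reach H) (Inverse.strictlyInverseˡ vmap u) (Inverse.strictlyInverseˡ vmap v)
           (≅-reach (connected (Inverse.from vmap u) (Inverse.from vmap v)))

reach-invariant : (G : Multigraph) (P : V G → Set) →
                  (∀ e → P (proj₁ (ends G e)) → P (proj₂ (ends G e))) →
                  (∀ e → P (proj₂ (ends G e)) → P (proj₁ (ends G e))) →
                  ∀ {u v} → Reach G u v → P v → P u
reach-invariant G P forward backward here Pv = Pv
reach-invariant G P forward backward (fwd e ends≡ walk) Pv =
  subst P (cong proj₁ ends≡)
    (backward e (subst P (sym (cong proj₂ ends≡)) (reach-invariant G P forward backward walk Pv)))
reach-invariant G P forward backward (bwd e ends≡ walk) Pv =
  subst P (cong proj₂ ends≡)
    (forward e (subst P (sym (cong proj₁ ends≡)) (reach-invariant G P forward backward walk Pv)))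

module Cayley (Γ : FiniteAbelianGroup) where
  open Multiples Γ

  cay-generated : ∀ {γ₁ γ₂} → Connected (Cay Γ γ₁ γ₂) → (P : Carrier Γ → Set) →
                  (∀ x → P x → P (x ∙ γ₁)) → (∀ x → P (x ∙ γ₁) → P x) →
                  (∀ x → P x → P (x ∙ γ₂)) → (∀ x → P (x ∙ γ₂) → P x) →
                  P ε → ∀ x → P x
  cay-generated {γ₁} {γ₂} connected P add₁ remove₁ add₂ remove₂ P0 x =
    reach-invariant (Cay Γ γ₁ γ₂) P forward backward (connected x ε) P0
    where
    forward : ∀ e → P (proj₁ (ends (Cay Γ γ₁ γ₂) e)) → P (proj₂ (ends (Cay Γ γ₁ γ₂) e))
    forward (y , false) = add₁ y
    forward (y , true)  = add₂ y
    backward : ∀ e → P (proj₂ (ends (Cay Γ γ₁ γ₂) e)) → P (proj₁ (ends (Cay Γ γ₁ γ₂) e))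
    backward (y , false) = remove₁ y
    backward (y , true)  = remove₂ y

  -- Replacing γ₂ by -γ₂ only reverses the γ₂-edges: the edge (x , x + γ₂)
  -- becomes the edge (x + γ₂ , x) of the new graph.
  cay-inverse : ∀ γ₁ γ₂ → Cay Γ γ₁ γ₂ ≅ Cay Γ γ₁ (γ₂ ⁻¹)
  cay-inverse γ₁ γ₂ = record
    { vmap = ↔-id (Carrier Γ)
    ; emap = mk↔ₛ′ reverse unreverse reverse∘unreverse unreverse∘reverse
    ; preserves = λ { (x , false) → inj₁ refl
                    ; (x , true)  → inj₂ (cong (x ∙ γ₂ ,_) (//-rightDividesʳ γ₂ x)) }
    }
    where
    reverse : Carrier Γ × Bool → Carrier Γ × Bool
    reverse (x , false) = x , false
    reverse (x , true)  = x ∙ γ₂ , true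
    unreverse : Carrier Γ × Bool → Carrier Γ × Bool
    unreverse (y , false) = y , false
    unreverse (y , true)  = y ∙ γ₂ ⁻¹ , true
    reverse∘unreverse : ∀ e → reverse (unreverse e) ≡ e
    reverse∘unreverse (y , false) = refl
    reverse∘unreverse (y , true)  = cong (_, true) (//-rightDividesˡ γ₂ y)
    unreverse∘reverse : ∀ e → unreverse (reverse e) ≡ e
    unreverse∘reverse (x , false) = refl
    unreverse∘reverse (x , true)  = cong (_, true) (//-rightDividesʳ γ₂ x)

-- Wrapping heights relative to the cyclic subgroup ⟨γ₁⟩, o(γ₁) = s

module Wrapping (Γ : FiniteAbelianGroup) (γ₁ : Carrier Γ) (s′ : ℕ) (ord : IsOrder Γ γ₁ (suc s′)) where
  open Multiples Γ

  s : ℕ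
  s = suc s′

  open Periodic γ₁ s (proj₁ (proj₂ ord)) public using (⊙-mod; ⊙-subtract; closed-under-inverse)

  Wraps : Carrier Γ → ℕ → Set
  Wraps g a = 0 < a × ∃[ r ] (r < s × a ⊙ g ≡ r ⊙ γ₁)

  wraps : ∀ {g a} m → 0 < a → a ⊙ g ≡ m ⊙ γ₁ → Wraps g a
  wraps m 0<a a⊙g≡m⊙γ₁ = 0<a , m % s , m%n<n m s , trans a⊙g≡m⊙γ₁ (sym (⊙-mod m))

  wraps? : ∀ g a → Dec (Wraps g a)
  wraps? g a = (0 <? a) ×-dec anyUpTo? (λ r → a ⊙ g ≟ r ⊙ γ₁) s

  LeastWrap : Carrier Γ → ℕ → Set
  LeastWrap g a = Wraps g a × (∀ b → Wraps g b → a ≤ b)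

  -- A period p of g wraps g (with residue 0), so a least height exists.
  least-wrap : ∀ g → ∃ (LeastWrap g)
  least-wrap g with period g
  ... | p , 0<p , p⊙g≡ε with least-witness (wraps? g) p (wraps 0 0<p p⊙g≡ε)
  ...   | a , a-wraps , below = a , a-wraps , λ b b-wraps → ≮⇒≥ (λ b<a → below b b<a b-wraps)

  inverse-residue : ∀ {g h a r} → a ⊙ g ∙ a ⊙ h ≡ ε → r < s → a ⊙ h ≡ r ⊙ γ₁ →
                    a ⊙ g ≡ ((s ∸ r) % s) ⊙ γ₁
  inverse-residue {g} {a = a} {r} cancels r<s a⊙h≡r⊙γ₁ = begin
    a ⊙ g               ≡⟨ ⊙-subtract {m = 0} (trans (cong (a ⊙ g ∙_) (sym a⊙h≡r⊙γ₁)) cancels) (<⇒≤ r<s) ⟩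
    (s ∸ r) ⊙ γ₁        ≡⟨ sym (⊙-mod (s ∸ r)) ⟩
    ((s ∸ r) % s) ⊙ γ₁  ∎
    where open ≡-Reasoning

  wraps-inverse : ∀ {g h a} → a ⊙ g ∙ a ⊙ h ≡ ε → Wraps h a → Wraps g a
  wraps-inverse {g} {h} {a} cancels (0<a , r , r<s , a⊙h≡r⊙γ₁) =
    wraps ((s ∸ r) % s) 0<a (inverse-residue {g} {h} {a} cancels r<s a⊙h≡r⊙γ₁)

  least-wrap-inverse : ∀ {g a} → LeastWrap g a → LeastWrap (g ⁻¹) a
  least-wrap-inverse {g} {a} (a-wraps , least) =
    wraps-inverse {g ⁻¹} {g} {a} (trans (comm (a ⊙ (g ⁻¹)) (a ⊙ g)) (⊙-inverse a g)) a-wraps ,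
    λ b b-wraps → least b (wraps-inverse {g} {g ⁻¹} {b} (⊙-inverse b g) b-wraps)

-- Coordinates a·γ₂ + b·γ₁ on Γ and the isomorphism with X(s,t,r)

module Ladder (Γ : FiniteAbelianGroup) (γ₁ γ₂ : Carrier Γ) (s′ : ℕ) (ord : IsOrder Γ γ₁ (suc s′)) where
  open Multiples Γ
  open Cayley Γ
  open Wrapping Γ γ₁ s′ ord

  point : ℕ → ℕ → Carrier Γ
  point a b = a ⊙ γ₂ ∙ b ⊙ γ₁

  point-suc₁ : ∀ a b → point a (suc b) ≡ point a b ∙ γ₁
  point-suc₁ a b = x∙yz≈xz∙y (a ⊙ γ₂) γ₁ (b ⊙ γ₁)

  point-suc₂ : ∀ a b → point (suc a) b ≡ point a b ∙ γ₂
  point-suc₂ a b = xy∙z≈yz∙x γ₂ (a ⊙ γ₂) (b ⊙ γ₁)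

  point-mod : ∀ a b → point a (b % s) ≡ point a b
  point-mod a b = cong (a ⊙ γ₂ ∙_) (⊙-mod b)

  point-shift : ∀ a d b → point (a + d) b ≡ a ⊙ γ₂ ∙ point d b
  point-shift a d b = trans (cong (_∙ b ⊙ γ₁) (⊙-+ a d γ₂)) (assoc (a ⊙ γ₂) (d ⊙ γ₂) (b ⊙ γ₁))

  point-wrap : ∀ {a r} → a ⊙ γ₂ ≡ r ⊙ γ₁ → ∀ b → point a b ≡ point 0 ((r + b) % s)
  point-wrap {a} {r} a⊙γ₂≡r⊙γ₁ b = begin
    a ⊙ γ₂ ∙ b ⊙ γ₁         ≡⟨ cong (_∙ b ⊙ γ₁) a⊙γ₂≡r⊙γ₁ ⟩
    r ⊙ γ₁ ∙ b ⊙ γ₁         ≡⟨ sym (⊙-+ r b γ₁) ⟩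
    (r + b) ⊙ γ₁            ≡⟨ sym (⊙-mod (r + b)) ⟩
    ((r + b) % s) ⊙ γ₁      ≡⟨ sym (identityˡ (((r + b) % s) ⊙ γ₁)) ⟩
    point 0 ((r + b) % s)   ∎
    where open ≡-Reasoning

  grid : ∀ {t} → Fin t × Fin s → Carrier Γ
  grid (i , j) = point (toℕ i) (toℕ j)

  grid-horizontal : ∀ {t} (i : Fin t) j → grid (i , (toℕ j + 1) mod s) ≡ grid (i , j) ∙ γ₁
  grid-horizontal i j = begin
    point (toℕ i) (toℕ ((toℕ j + 1) mod s))  ≡⟨ cong (point (toℕ i)) (toℕ-fromℕ< (m%n<n (toℕ j + 1) s)) ⟩
    point (toℕ i) ((toℕ j + 1) % s)          ≡⟨ point-mod (toℕ i) (toℕ j + 1) ⟩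
    point (toℕ i) (toℕ j + 1)                ≡⟨ cong (point (toℕ i)) (+-comm (toℕ j) 1) ⟩
    point (toℕ i) (suc (toℕ j))              ≡⟨ point-suc₁ (toℕ i) (toℕ j) ⟩
    grid (i , j) ∙ γ₁                        ∎
    where open ≡-Reasoning

  grid-vertical : ∀ {t} (i : Fin t) j → grid (fsuc i , j) ≡ grid (inject₁ i , j) ∙ γ₂
  grid-vertical i j =
    trans (point-suc₂ (toℕ i) (toℕ j)) (cong (λ a → point a (toℕ j) ∙ γ₂) (sym (toℕ-inject₁ i)))

  grid-diagonal : ∀ {t′ r} → suc t′ ⊙ γ₂ ≡ r ⊙ γ₁ →
                  ∀ j → grid {suc t′} (fzero , (toℕ j + r) mod s) ≡ grid (fromℕ t′ , j) ∙ γ₂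
  grid-diagonal {t′} {r} wrap j = begin
    point 0 (toℕ ((toℕ j + r) mod s))  ≡⟨ cong (point 0) (toℕ-fromℕ< (m%n<n (toℕ j + r) s)) ⟩
    point 0 ((toℕ j + r) % s)          ≡⟨ cong (λ b → point 0 (b % s)) (+-comm (toℕ j) r) ⟩
    point 0 ((r + toℕ j) % s)          ≡⟨ sym (point-wrap {suc t′} {r} wrap (toℕ j)) ⟩
    point (suc t′) (toℕ j)             ≡⟨ point-suc₂ t′ (toℕ j) ⟩
    point t′ (toℕ j) ∙ γ₂              ≡⟨ cong (λ a → point a (toℕ j) ∙ γ₂) (sym (toℕ-fromℕ t′)) ⟩
    grid (fromℕ t′ , j) ∙ γ₂           ∎
    where open ≡-Reasoning

  module Rectangle (connected : Connected (Cay Γ γ₁ γ₂)) {a₀ : ℕ} (least : LeastWrap γ₂ a₀) where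

    Covered : Carrier Γ → Set
    Covered x = ∃[ a ] ∃[ b ] (a < a₀ × b < s × point a b ≡ x)

    covered-+γ₁ : ∀ x → Covered x → Covered (x ∙ γ₁)
    covered-+γ₁ _ (a , b , a<a₀ , b<s , refl) =
      a , suc b % s , a<a₀ , m%n<n (suc b) s , trans (point-mod a (suc b)) (point-suc₁ a b)

    -- Leaving the top row along γ₂ re-enters the bottom row, shifted by r₀.
    covered-+γ₂ : ∀ x → Covered x → Covered (x ∙ γ₂)
    covered-+γ₂ _ (a , b , a<a₀ , b<s , refl) with suc a <? a₀
    ... | yes 1+a<a₀ = suc a , b , 1+a<a₀ , b<s , point-suc₂ a b
    ... | no  1+a≮a₀ with proj₁ least
    ...   | 0<a₀ , r₀ , _ , a₀⊙γ₂≡r₀⊙γ₁ =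
      0 , (r₀ + b) % s , 0<a₀ , m%n<n (r₀ + b) s , (begin
        point 0 ((r₀ + b) % s)  ≡⟨ sym (point-wrap {a₀} {r₀} a₀⊙γ₂≡r₀⊙γ₁ b) ⟩
        point a₀ b              ≡⟨ cong (λ h → point h b) (sym (≤-antisym a<a₀ (≮⇒≥ 1+a≮a₀))) ⟩
        point (suc a) b         ≡⟨ point-suc₂ a b ⟩
        point a b ∙ γ₂          ∎)
      where open ≡-Reasoning

    -- Subtracting γ₁ or γ₂ is adding a multiple, so connectivity covers Γ.
    covered : ∀ x → Covered x
    covered with period γ₂
    ... | p , 0<p , p⊙γ₂≡ε =
      cay-generated connected Covered
        covered-+γ₁ (closed-under-inverse Covered covered-+γ₁)
        covered-+γ₂ (Periodic.closed-under-inverse γ₂ p {{>-nonZero 0<p}} p⊙γ₂≡ε Covered covered-+γ₂)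
        (0 , 0 , proj₁ (proj₁ least) , s≤s z≤n , identityˡ ε)

    -- Points of the rectangle at heights a ≤ a′ coincide only when equal:
    -- otherwise (a′ - a)·γ₂ ∈ ⟨γ₁⟩ with 0 < a′ - a < a₀.
    point-injective-≤ : ∀ {a a′ b b′} → a ≤ a′ → a′ < a₀ → b < s → b′ < s →
                        point a b ≡ point a′ b′ → a ≡ a′ × b ≡ b′
    point-injective-≤ {a} {a′} {b} {b′} a≤a′ a′<a₀ b<s b′<s same = a≡a′ , b≡b′
      where
      d : ℕ
      d = a′ ∸ a
      b⊙γ₁≡point-d : b ⊙ γ₁ ≡ point d b′
      b⊙γ₁≡point-d = ∙-cancelˡ (a ⊙ γ₂) (b ⊙ γ₁) (point d b′)
        (trans same (trans (cong (λ h → point h b′) (sym (m+[n∸m]≡n a≤a′))) (point-shift a d b′)))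
      a≡a′ : a ≡ a′
      a≡a′ = ≤-difference a≤a′ λ 0<d →
        <⇒≱ (≤-<-trans (m∸n≤m a′ a) a′<a₀)
            (proj₂ least d (wraps (b + (s ∸ b′)) 0<d (⊙-subtract {m = b} (sym b⊙γ₁≡point-d) (<⇒≤ b′<s))))
      b≡b′ : b ≡ b′
      b≡b′ = order-injective ord b<s b′<s
        (∙-cancelˡ (a ⊙ γ₂) (b ⊙ γ₁) (b′ ⊙ γ₁) (trans same (cong (λ h → point h b′) (sym a≡a′))))

    point-injective : ∀ {a a′ b b′} → a < a₀ → a′ < a₀ → b < s → b′ < s →
                      point a b ≡ point a′ b′ → a ≡ a′ × b ≡ b′
    point-injective {a} {a′} a<a₀ a′<a₀ b<s b′<s same with ≤-total a a′
    ... | inj₁ a≤a′ = point-injective-≤ a≤a′ a′<a₀ b<s b′<s same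
    ... | inj₂ a′≤a with point-injective-≤ a′≤a a<a₀ b′<s b<s (sym same)
    ...   | a′≡a , b′≡b = sym a′≡a , sym b′≡b

    cell : ∀ {x} → Covered x → Fin a₀ × Fin s
    cell (a , b , a<a₀ , b<s , _) = fromℕ< a<a₀ , fromℕ< b<s

    grid-cell : ∀ {x} (c : Covered x) → grid (cell c) ≡ x
    grid-cell (a , b , a<a₀ , b<s , refl) = cong₂ point (toℕ-fromℕ< a<a₀) (toℕ-fromℕ< b<s)

    grid-injective : ∀ {p q : Fin a₀ × Fin s} → grid p ≡ grid q → p ≡ q
    grid-injective {i , j} {i′ , j′} same
      with point-injective (toℕ<n i) (toℕ<n i′) (toℕ<n j) (toℕ<n j′) same
    ... | i≡i′ , j≡j′ = cong₂ _,_ (toℕ-injective i≡i′) (toℕ-injective j≡j′)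

    coordinates : (Fin a₀ × Fin s) ↔ Carrier Γ
    coordinates = mk↔ₛ′ grid (λ x → cell (covered x))
      (λ x → grid-cell (covered x)) (λ p → grid-injective (grid-cell (covered (grid p))))

    -- Counting: |Γ| = a₀·s, so the least wrapping height is |Γ|/s.
    height : size Γ / s ≡ a₀
    height = trans (cong (_/ s) (↔⇒≡ (↔-sym *↔× ↔-∘ (↔-sym coordinates ↔-∘ enum Γ)))) (m*n/n≡m a₀ s)

  module LadderIso {t′ r : ℕ} (wrap : suc t′ ⊙ γ₂ ≡ r ⊙ γ₁)
                   (coordinates : (Fin (suc t′) × Fin s) ↔ Carrier Γ)
                   (on-grid : ∀ p → Inverse.to coordinates p ≡ grid p) where
    private
      ψ : Fin (suc t′) × Fin s → Carrier Γ
      ψ = Inverse.to coordinates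
      φ : Carrier Γ → Fin (suc t′) × Fin s
      φ = Inverse.from coordinates

    edge : E (X s (suc t′) r) → Carrier Γ × Bool
    edge (inj₁ p)              = ψ p , false
    edge (inj₂ (inj₁ (i , j))) = ψ (inject₁ i , j) , true
    edge (inj₂ (inj₂ j))       = ψ (fromℕ t′ , j) , true

    γ₂-edge : ∀ {i : Fin (suc t′)} → View i → Fin s → E (X s (suc t′) r)
    γ₂-edge ‵fromℕ            j = inj₂ (inj₂ j)
    γ₂-edge (‵inj₁ {i = i} _) j = inj₂ (inj₁ (i , j))

    γ₂-edge-at : Fin (suc t′) × Fin s → E (X s (suc t′) r)
    γ₂-edge-at (i , j) = γ₂-edge (view i) j

    unedge : Carrier Γ × Bool → E (X s (suc t′) r)
    unedge (x , false) = inj₁ (φ x)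
    unedge (x , true)  = γ₂-edge-at (φ x)

    edge-γ₂-edge : ∀ {i} (v : View i) j → edge (γ₂-edge v j) ≡ (ψ (i , j) , true)
    edge-γ₂-edge ‵fromℕ    j = refl
    edge-γ₂-edge (‵inj₁ _) j = refl

    edge-unedge : ∀ e → edge (unedge e) ≡ e
    edge-unedge (x , false) = cong (_, false) (Inverse.strictlyInverseˡ coordinates x)
    edge-unedge (x , true)  = trans (edge-γ₂-edge (view (proj₁ (φ x))) (proj₂ (φ x)))
                                    (cong (_, true) (Inverse.strictlyInverseˡ coordinates x))

    unedge-edge : ∀ e → unedge (edge e) ≡ e
    unedge-edge (inj₁ p) = cong inj₁ (Inverse.strictlyInverseʳ coordinates p)
    unedge-edge (inj₂ (inj₁ (i , j))) =
      trans (cong γ₂-edge-at (Inverse.strictlyInverseʳ coordinates (inject₁ i , j)))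
            (cong (λ v → γ₂-edge v j) (view-inject₁ i))
    unedge-edge (inj₂ (inj₂ j)) =
      trans (cong γ₂-edge-at (Inverse.strictlyInverseʳ coordinates (fromℕ t′ , j)))
            (cong (λ v → γ₂-edge v j) (view-fromℕ t′))

    step : ∀ {p q} g → grid q ≡ grid p ∙ g → ψ p ∙ g ≡ ψ q
    step {p} {q} g grid-step = trans (cong (_∙ g) (on-grid p)) (trans (sym grid-step) (sym (on-grid q)))

    edge-ends : ∀ e → ends (Cay Γ γ₁ γ₂) (edge e) ≡
                      (ψ (proj₁ (ends (X s (suc t′) r) e)) , ψ (proj₂ (ends (X s (suc t′) r) e)))
    edge-ends (inj₁ (i , j))        = cong (ψ (i , j) ,_) (step γ₁ (grid-horizontal i j))
    edge-ends (inj₂ (inj₁ (i , j))) = cong (ψ (inject₁ i , j) ,_) (step γ₂ (grid-vertical i j))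
    edge-ends (inj₂ (inj₂ j))       = cong (ψ (fromℕ t′ , j) ,_) (step γ₂ (grid-diagonal {t′} wrap j))

    iso : X s (suc t′) r ≅ Cay Γ γ₁ γ₂
    iso = record
      { vmap      = coordinates
      ; emap      = mk↔ₛ′ edge unedge edge-unedge unedge-edge
      ; preserves = λ e → inj₁ (edge-ends e)
      }

  cay≅X : Connected (Cay Γ γ₁ γ₂) → ∀ {t r} → LeastWrap γ₂ t → t ⊙ γ₂ ≡ r ⊙ γ₁ →
          Cay Γ γ₁ γ₂ ≅ X s t r
  cay≅X connected {zero}   ((() , _) , _) _
  cay≅X connected {suc t′} least wrap =
    ≅-sym (LadderIso.iso wrap (Rectangle.coordinates connected least) (λ _ → refl))

proposition13 : (Γ : FiniteAbelianGroup) (γ₁ γ₂ : Carrier Γ)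
    → Connected (Cay Γ γ₁ γ₂)
    → (s : ℕ) .{{_ : NonZero s}} → IsOrder Γ γ₁ s
    → (t : ℕ) → t ≡ size Γ / s
    → ((0 < t × ∃[ r ] (r < s × _·_ {Γ} t γ₂ ≡ _·_ {Γ} r γ₁))
       × (∀ a → 0 < a → ∃[ r ] (r < s × _·_ {Γ} a γ₂ ≡ _·_ {Γ} r γ₁) → t ≤ a))
      × (∀ r → r < s → _·_ {Γ} t γ₂ ≡ _·_ {Γ} r γ₁
         → (Cay Γ γ₁ γ₂ ≅ X s t r) × (Cay Γ γ₁ γ₂ ≅ X s t ((s ∸ r) % s)))
proposition13 Γ γ₁ γ₂ connected (suc s′) ord t t≡|Γ|/s =
  (proj₁ t-least , λ a 0<a a-wraps → proj₂ t-least a (0<a , a-wraps)) ,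
  λ r r<s t⊙γ₂≡r⊙γ₁ →
    cay≅X connected t-least t⊙γ₂≡r⊙γ₁ ,
    ≅-trans (cay-inverse γ₁ γ₂)
      (Inverted.cay≅X (≅-connected (cay-inverse γ₁ γ₂) connected) (least-wrap-inverse t-least)
        (inverse-residue {γ₂ ⁻¹} {γ₂} {t} (trans (comm (t ⊙ (γ₂ ⁻¹)) (t ⊙ γ₂)) (⊙-inverse t γ₂))
                         r<s t⊙γ₂≡r⊙γ₁))
  where
  open Multiples Γ
  open Cayley Γ
  open Wrapping Γ γ₁ s′ ord
  open Ladder Γ γ₁ γ₂ s′ ord
  module Inverted = Ladder Γ γ₁ (γ₂ ⁻¹) s′ ord

  t-least : LeastWrap γ₂ t
  t-least with least-wrap γ₂
  ... | a₀ , a₀-least =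
    subst (LeastWrap γ₂) (sym (trans t≡|Γ|/s (Rectangle.height connected a₀-least))) a₀-least
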